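{- For all integers $k \ge 3$, \[ m(k) \le \min\Big\{1 + m(k-1),\ \min_{\substack{1<d<k\\ d \mid k}} \{m(d) + m(k/d)\}\Big\}. \]
   Context: A topology on a finite set $X$ is a collection of subsets of $X$ containing $\emptyset$ and $X$ and closed under unions and finite intersections; its members are open sets. For an integer $k \ge 2$, $m(k)$ is the smallest positive integer $n$ such that there exists a topology on an $n$-point set having exactly $k$ open sets. The inner minimum over an empty set of divisors (when $k$ is prime) is understood as $+\infty$. -}

module Defs where

open import Data.Nat using (ℕ; _≤_)
open import Data.List using (List; length)
open import Data.List.Membership.Propositional using (_∈_)
open import Data.List.Relation.Unary.Unique.Propositional using (Unique)
open import Data.Fin.Subset using (Subset; ⊥; ⊤; _∪_; _∩_)
open import Data.Product using (Σ; _×_)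
open import Relation.Binary.PropositionalEquality using (_≡_)

-- On a finite set, closure under arbitrary unions is
-- equivalent to containing ∅ and being closed under binary unions.
record Topology (n : ℕ) : Set where
  field
    opens    : List (Subset n)
    unique   : Unique opens
    empty∈   : ⊥ ∈ opens
    full∈    : ⊤ ∈ opens
    ∪-closed : ∀ {U V} → U ∈ opens → V ∈ opens → (U ∪ V) ∈ opens
    ∩-closed : ∀ {U V} → U ∈ opens → V ∈ opens → (U ∩ V) ∈ opens

open Topology public

HasTopologyWith : ℕ → ℕ → Set
HasTopologyWith n k = Σ (Topology n) λ T → length (opens T) ≡ k

-- IsM k n : n = m(k), the smallest positive integer n such that some
-- topology on an n-point set has exactly k open sets.
IsM : ℕ → ℕ → Set
IsM k n = (1 ≤ n) × HasTopologyWith n k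
          × (∀ n′ → 1 ≤ n′ → HasTopologyWith n′ k → n ≤ n′)

-- Both bounds come from constructions on witnessing topologies. Adjoining a
-- point p whose only open neighbourhood is the whole space turns a topology
-- with k − 1 open sets on n points into one with k open sets on n + 1 points
-- (the new opens are ∅ and the sets U ∪ {p}). The product of topologies with
-- d and e open sets on x and y points has d·e open sets on x + y points.
-- Minimality of m(k) then gives both inequalities.
module Submission where

open import Defs
open import Data.Nat using (ℕ; zero; suc; _≤_; _<_; _+_; _*_; _∸_; s≤s; z≤n)
open import Data.Nat.Properties using (≤-trans; m≤m+n)
open import Data.Product using (_×_; _,_)
open import Data.Bool using (true; false; _∨_; _∧_)
open import Data.List using (List; []; _∷_; length; map; cartesianProductWith)
open import Data.List.Properties using (length-++; length-map)
open import Data.Vec using (replicate; _++_) renaming (_∷_ to _∷ᵥ_)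
open import Data.Vec.Properties using (++-injective; zipWith-++; ∷-injectiveʳ)
open import Data.List.Membership.Propositional using (_∈_)
open import Data.List.Membership.Propositional.Properties
  using (∈-map⁺; ∈-map⁻; ∈-cartesianProductWith⁺; ∈-cartesianProductWith⁻)
open import Data.List.Relation.Unary.All using (All; tabulate)
open import Data.List.Relation.Unary.AllPairs using (_∷_)
open import Data.List.Relation.Unary.Any using (here; there)
open import Data.List.Relation.Unary.Unique.Propositional.Properties
  using (map⁺; cartesianProductWith⁺)
open import Data.Fin.Subset using (Subset; ⊥; ⊤; _∪_; _∩_)
open import Data.Fin.Subset.Properties
  using (∪-identityˡ; ∪-identityʳ; ∩-zeroˡ; ∩-zeroʳ)
open import Relation.Binary.PropositionalEquality
  using (_≡_; _≢_; refl; cong; cong₂; sym; trans; subst)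

replicate-+ : ∀ {A : Set} (a : A) m n →
  replicate (m + n) a ≡ replicate m a ++ replicate n a
replicate-+ a zero    n = refl
replicate-+ a (suc m) n = cong (a ∷ᵥ_) (replicate-+ a m n)

length-cartesianProductWith : ∀ {A B C : Set} (f : A → B → C) xs ys →
  length (cartesianProductWith f xs ys) ≡ length xs * length ys
length-cartesianProductWith f []       ys = refl
length-cartesianProductWith f (x ∷ xs) ys = trans (length-++ (map (f x) ys))
  (cong₂ _+_ (length-map (f x) ys) (length-cartesianProductWith f xs ys))

module _ {n : ℕ} (T : Topology n) where

  private
    withPoint : List (Subset (suc n))
    withPoint = map (true ∷ᵥ_) (opens T)

    opens⁺ : List (Subset (suc n))
    opens⁺ = ⊥ ∷ withPoint

    ⊥∉withPoint : All (⊥ ≢_) withPoint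
    ⊥∉withPoint = tabulate ⊥≢
      where
      ⊥≢ : ∀ {U} → U ∈ withPoint → ⊥ ≢ U
      ⊥≢ U∈ with ∈-map⁻ _ U∈
      ... | _ , _ , refl = λ ()

    ∪-closed⁺ : ∀ {U V} → U ∈ opens⁺ → V ∈ opens⁺ → (U ∪ V) ∈ opens⁺
    ∪-closed⁺ {V = V} (here refl) V∈ rewrite ∪-identityˡ V = V∈
    ∪-closed⁺ {U = U} (there U∈) (here refl) rewrite ∪-identityʳ U = there U∈
    ∪-closed⁺ (there U∈) (there V∈) with ∈-map⁻ _ U∈ | ∈-map⁻ _ V∈
    ... | _ , U′∈ , refl | _ , V′∈ , refl = there (∈-map⁺ _ (∪-closed T U′∈ V′∈))

    ∩-closed⁺ : ∀ {U V} → U ∈ opens⁺ → V ∈ opens⁺ → (U ∩ V) ∈ opens⁺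
    ∩-closed⁺ {V = V} (here refl) _ rewrite ∩-zeroˡ V = here refl
    ∩-closed⁺ {U = U} (there _) (here refl) rewrite ∩-zeroʳ U = here refl
    ∩-closed⁺ (there U∈) (there V∈) with ∈-map⁻ _ U∈ | ∈-map⁻ _ V∈
    ... | _ , U′∈ , refl | _ , V′∈ , refl = there (∈-map⁺ _ (∩-closed T U′∈ V′∈))

  addPoint : Topology (suc n)
  addPoint = record
    { opens    = opens⁺
    ; unique   = ⊥∉withPoint ∷ map⁺ ∷-injectiveʳ (unique T)
    ; empty∈   = here refl
    ; full∈    = there (∈-map⁺ _ (full∈ T))
    ; ∪-closed = ∪-closed⁺
    ; ∩-closed = ∩-closed⁺
    }

  length-addPoint : length (opens addPoint) ≡ suc (length (opens T))
  length-addPoint = cong suc (length-map _ (opens T))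

module _ {m n : ℕ} (T : Topology m) (S : Topology n) where

  private
    opens× : List (Subset (m + n))
    opens× = cartesianProductWith _++_ (opens T) (opens S)

    pair∈ : ∀ {U V} → U ∈ opens T → V ∈ opens S → (U ++ V) ∈ opens×
    pair∈ = ∈-cartesianProductWith⁺ _++_

    ∪-closed× : ∀ {U V} → U ∈ opens× → V ∈ opens× → (U ∪ V) ∈ opens×
    ∪-closed× U∈ V∈ with ∈-cartesianProductWith⁻ _++_ (opens T) (opens S) U∈
                       | ∈-cartesianProductWith⁻ _++_ (opens T) (opens S) V∈
    ... | A , B , A∈ , B∈ , refl | C , D , C∈ , D∈ , refl
      rewrite zipWith-++ _∨_ A B C D = pair∈ (∪-closed T A∈ C∈) (∪-closed S B∈ D∈)

    ∩-closed× : ∀ {U V} → U ∈ opens× → V ∈ opens× → (U ∩ V) ∈ opens×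
    ∩-closed× U∈ V∈ with ∈-cartesianProductWith⁻ _++_ (opens T) (opens S) U∈
                       | ∈-cartesianProductWith⁻ _++_ (opens T) (opens S) V∈
    ... | A , B , A∈ , B∈ , refl | C , D , C∈ , D∈ , refl
      rewrite zipWith-++ _∧_ A B C D = pair∈ (∩-closed T A∈ C∈) (∩-closed S B∈ D∈)

  product : Topology (m + n)
  product = record
    { opens    = opens×
    ; unique   = cartesianProductWith⁺ _++_ (λ {U} {V} → ++-injective U V)
                   (unique T) (unique S)
    ; empty∈   = subst (_∈ opens×) (sym (replicate-+ false m n))
                   (pair∈ (empty∈ T) (empty∈ S))
    ; full∈    = subst (_∈ opens×) (sym (replicate-+ true m n))
                   (pair∈ (full∈ T) (full∈ S))
    ; ∪-closed = ∪-closed×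
    ; ∩-closed = ∩-closed×
    }

  length-product : length (opens product) ≡ length (opens T) * length (opens S)
  length-product = length-cartesianProductWith _++_ (opens T) (opens S)

hasTopologyWith-suc : ∀ {n k} → HasTopologyWith n k → HasTopologyWith (suc n) (suc k)
hasTopologyWith-suc (T , |T|≡k) = addPoint T , trans (length-addPoint T) (cong suc |T|≡k)

hasTopologyWith-* : ∀ {m n k l} → HasTopologyWith m k → HasTopologyWith n l →
  HasTopologyWith (m + n) (k * l)
hasTopologyWith-* (T , |T|≡k) (S , |S|≡l) =
  product T S , trans (length-product T S) (cong₂ _*_ |T|≡k |S|≡l)

corollary2p18 : ∀ k → 3 ≤ k → ∀ a → IsM k a →
    ((∀ b → IsM (k ∸ 1) b → a ≤ 1 + b)
    × (∀ d e → 1 < d → d < k → d * e ≡ k →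
         ∀ x y → IsM d x → IsM e y → a ≤ x + y))
corollary2p18 (suc k) _ a (_ , _ , a-minimal) = addPointBound , productBound
  where
  addPointBound : ∀ b → IsM k b → a ≤ 1 + b
  addPointBound b (_ , b-has-k , _) =
    a-minimal (suc b) (s≤s z≤n) (hasTopologyWith-suc b-has-k)

  productBound : ∀ d e → 1 < d → d < suc k → d * e ≡ suc k →
    ∀ x y → IsM d x → IsM e y → a ≤ x + y
  productBound d e _ _ d*e≡k x y (1≤x , x-has-d , _) (_ , y-has-e , _) =
    a-minimal (x + y) (≤-trans 1≤x (m≤m+n x y))
      (subst (HasTopologyWith (x + y)) d*e≡k (hasTopologyWith-* x-has-d y-has-e))
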